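{- Let $N$ be a prime. Every minimal monomial solution of $(E_N)$ different from $(0,0)$ is irreducible.
   Context: For $a_1,\dots,a_n\in\mathbb{Z}/N\mathbb{Z}$ set $M_n(a_1,\dots,a_n)=\begin{pmatrix}a_n&-1\\1&0\end{pmatrix}\cdots\begin{pmatrix}a_1&-1\\1&0\end{pmatrix}$. An $n$-tuple is a solution of $(E_N)$ if $M_n(a_1,\dots,a_n)=\pm\mathrm{Id}$ over $\mathbb{Z}/N\mathbb{Z}$. For $k\in\mathbb{Z}/N\mathbb{Z}$, a minimal $k$-monomial solution is a solution $(k,k,\dots,k)\in(\mathbb{Z}/N\mathbb{Z})^n$ where $n\ge1$ is the smallest integer for which $(k,\dots,k)\in(\mathbb{Z}/N\mathbb{Z})^n$ is a solution; a minimal monomial solution is a minimal $k$-monomial solution for some $k$. The sum of $(a_1,\dots,a_n)$ and $(b_1,\dots,b_m)$ is $(a_1+b_m,a_2,\dots,a_{n-1},a_n+b_1,b_2,\dots,b_{m-1})$. Two $n$-tuples are equivalent ($\sim$) if one is a cyclic permutation of the other or of its reversal. A solution $(c_1,\dots,c_n)$ with $n\ge3$ is reducible if there exist solutions $(a_1,\dots,a_m)$, $(b_1,\dots,b_l)$ with $m,l\ge3$ and $(c_1,\dots,c_n)\sim(a_1,\dots,a_m)\oplus(b_1,\dots,b_l)$; irreducible otherwise. -}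

module Defs where

open import Data.Nat as ℕ using (ℕ; suc; _≤_; _<_)
open import Data.Integer as ℤ using (ℤ; +_; _+_; _-_; _*_; -_)
open import Data.Integer.Divisibility using (_∣_)
open import Data.List using (List; []; _∷_; _++_; length; replicate; reverse; drop; take)
open import Data.List.Relation.Binary.Pointwise using (Pointwise)
open import Data.Product using (_×_; ∃; ∃-syntax; Σ-syntax)
open import Data.Sum using (_⊎_)
open import Relation.Nullary using (¬_)

-- Elements of ℤ/Nℤ are represented by integers; equality in ℤ/Nℤ is
-- congruence modulo N.
_≡[_]_ : ℤ → ℕ → ℤ → Set
x ≡[ N ] y = (+ N) ∣ (x - y)

record Mat : Set where
  constructor mat
  field
    m11 m12 m21 m22 : ℤ

_·_ : Mat → Mat → Mat
mat a b c d · mat e f g h = mat (a * e + b * g) (a * f + b * h) (c * e + d * g) (c * f + d * h)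

Id : Mat
Id = mat (+ 1) (+ 0) (+ 0) (+ 1)

A : ℤ → Mat
A a = mat a (- (+ 1)) (+ 1) (+ 0)

M : List ℤ → Mat
M []       = Id
M (a ∷ as) = M as · A a

_≡M[_]_ : Mat → ℕ → Mat → Set
mat a b c d ≡M[ N ] mat e f g h =
  (a ≡[ N ] e) × (b ≡[ N ] f) × (c ≡[ N ] g) × (d ≡[ N ] h)

negM : Mat → Mat
negM (mat a b c d) = mat (- a) (- b) (- c) (- d)

-- (a₁,…,aₙ) is a solution of (E_N): M_n(a₁,…,aₙ) = ± Id over ℤ/Nℤ
Solution : ℕ → List ℤ → Set
Solution N as = (M as ≡M[ N ] Id) ⊎ (M as ≡M[ N ] negM Id)

MinimalMonomial : ℕ → ℤ → ℕ → Set
MinimalMonomial N k n =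
  1 ≤ n × Solution N (replicate n k)
  × (∀ m → 1 ≤ m → m < n → ¬ Solution N (replicate m k))

lastNE : ℤ → List ℤ → ℤ
lastNE x []       = x
lastNE x (y ∷ ys) = lastNE y ys

initNE : ℤ → List ℤ → List ℤ
initNE x []       = []
initNE x (y ∷ ys) = x ∷ initNE y ys

-- (a₁,…,aₙ) ⊕ (b₁,…,bₘ) = (a₁+bₘ, a₂,…,aₙ₋₁, aₙ+b₁, b₂,…,bₘ₋₁)
-- (only meaningful for n, m ≥ 2; junk value [] otherwise)
_⊕_ : List ℤ → List ℤ → List ℤ
(a₁ ∷ a₂ ∷ as) ⊕ (b₁ ∷ b₂ ∷ bs) =
  (a₁ + lastNE b₂ bs) ∷ (initNE a₂ as ++ ((lastNE a₂ as + b₁) ∷ initNE b₂ bs))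
_ ⊕ _ = []

rot : ℕ → List ℤ → List ℤ
rot k xs = drop k xs ++ take k xs

Equiv : ℕ → List ℤ → List ℤ → Set
Equiv N c d = ∃[ k ] (Pointwise (λ x y → x ≡[ N ] y) (rot k c) d
                     ⊎ Pointwise (λ x y → x ≡[ N ] y) (rot k (reverse c)) d)

Reducible : ℕ → List ℤ → Set
Reducible N c =
  3 ≤ length c ×
  ∃[ a ] ∃[ b ] (Solution N a × Solution N b × 3 ≤ length a × 3 ≤ length b
                 × Equiv N c (a ⊕ b))

Irreducible : ℕ → List ℤ → Set
Irreducible N c = ¬ Reducible N c

-- Suppose (k,…,k) ∼ a ⊕ b with a a solution and |a|, |b| ≥ 3. Modulo N, a = (a₁, k, …, k, aₘ)
-- with j = |a| − 2 inner entries, and by Cayley–Hamilton (A k)ʲ = x·Id + y·A k for some x, y.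
-- Comparing entries in A aₘ (x·Id + y·A k) A a₁ = ±Id and using that N is prime gives either
-- y = 0, so that (k,…,k) of length j is a solution, or a₁ = aₘ = k, so that (k,…,k) of length
-- |a| is a solution. Both lengths are positive and less than |a ⊕ b|, contradicting minimality.
module Submission where

open import Defs
open import Data.Nat as ℕ using (ℕ; zero; suc; z≤n; s≤s; _≤_; _<_)
open import Data.Nat.Properties using (+-suc; m≤m+n; m≤n⇒m≤1+n; m<m+n)
open import Data.Nat.Primality using (Prime; euclidsLemma)
import Data.Nat.Divisibility as ℕᵈ
open import Data.Integer using (ℤ; +_; _+_; _-_; _*_; -_; ∣_∣)
open import Data.Integer.Properties using (abs-*; +-comm; +-inverseʳ; *-assoc; *-identityˡ)
open import Data.Integer.Divisibility.Signed
  using (_∣_; divides; ∣m∣n⇒∣m+n; ∣m∣n⇒∣m-n; ∣m+n∣n⇒∣m; ∣n⇒∣m*n; ∣ᵤ⇒∣; ∣⇒∣ᵤ)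
open import Data.Integer.Tactic.RingSolver using (solve; solve-∀)
open import Data.List using (List; []; _∷_; _++_; length; replicate; reverse; drop; take)
open import Data.List.Properties using (length-++; length-replicate; take++drop≡id)
open import Data.List.Relation.Unary.All using (All)
import Data.List.Relation.Unary.All.Properties as All
open import Data.List.Relation.Binary.Pointwise using (Pointwise; Pointwise-length)
import Data.List.Relation.Binary.Pointwise as Pointwise
open import Data.List.Relation.Binary.Permutation.Propositional using (_↭_; ↭-sym; ↭-trans; ↭-reflexive)
open import Data.List.Relation.Binary.Permutation.Propositional.Properties
  using (++-comm; ↭-reverse; ↭-length; All-resp-↭)
open import Data.Product using (_×_; _,_; ∃-syntax)
open import Data.Sum as Sum using (_⊎_; inj₁; inj₂; [_,_]′)
open import Function using (_∘_)
open import Relation.Nullary using (¬_)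
open import Relation.Binary.PropositionalEquality
  using (_≡_; refl; sym; trans; cong; cong₂; subst; module ≡-Reasoning)

∣-resp-≡ : ∀ {d m n} → d ∣ m → m ≡ n → d ∣ n
∣-resp-≡ d∣m refl = d∣m

∣-cancel-unit : ∀ {d n} e → e * e ≡ + 1 → d ∣ e * n → d ∣ n
∣-cancel-unit {n = n} e e²≡1 d∣en = ∣-resp-≡ (∣n⇒∣m*n e d∣en) (begin
  e * (e * n) ≡⟨ *-assoc e e n ⟨
  e * e * n   ≡⟨ cong (_* n) e²≡1 ⟩
  + 1 * n     ≡⟨ *-identityˡ n ⟩
  n           ∎)
  where open ≡-Reasoning

mat-cong : ∀ {a b c d a′ b′ c′ d′} → a ≡ a′ → b ≡ b′ → c ≡ c′ → d ≡ d′ →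
           mat a b c d ≡ mat a′ b′ c′ d′
mat-cong refl refl refl refl = refl

·-assoc : ∀ X Y Z → (X · Y) · Z ≡ X · (Y · Z)
·-assoc (mat a b c d) (mat e f g h) (mat i j k l) =
  mat-cong (entry a b e f g h i k) (entry a b e f g h j l)
           (entry c d e f g h i k) (entry c d e f g h j l)
  where
  entry : ∀ a b e f g h i k →
          (a * e + b * g) * i + (a * f + b * h) * k ≡ a * (e * i + f * k) + b * (g * i + h * k)
  entry = solve-∀

·-identityˡ : ∀ X → Id · X ≡ X
·-identityˡ (mat a b c d) = mat-cong (first a c) (first b d) (second a c) (second b d)
  where
  first : ∀ a c → + 1 * a + + 0 * c ≡ a
  first = solve-∀
  second : ∀ a c → + 0 * a + + 1 * c ≡ c
  second = solve-∀

·-identityʳ : ∀ X → X · Id ≡ X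
·-identityʳ (mat a b c d) = mat-cong (first a b) (second a b) (first c d) (second c d)
  where
  first : ∀ a b → a * + 1 + b * + 0 ≡ a
  first = solve-∀
  second : ∀ a b → a * + 0 + b * + 1 ≡ b
  second = solve-∀

A-· : ∀ a p q r t → A a · mat p q r t ≡ mat (a * p - r) (a * q - t) p q
A-· a p q r t = mat-cong (first a p r) (first a q t) (second p r) (second q t)
  where
  first : ∀ a p r → a * p + - + 1 * r ≡ a * p - r
  first = solve-∀
  second : ∀ p r → + 1 * p + + 0 * r ≡ p
  second = solve-∀

·-A : ∀ p q r t a → mat p q r t · A a ≡ mat (p * a + q) (- p) (r * a + t) (- r)
·-A p q r t a = mat-cong (first p q a) (second p q) (first r t a) (second r t)
  where
  first : ∀ p q a → p * a + q * + 1 ≡ p * a + q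
  first = solve-∀
  second : ∀ p q → p * - + 1 + q * + 0 ≡ - p
  second = solve-∀

M-∷ʳ : ∀ xs y → M (xs ++ y ∷ []) ≡ A y · M xs
M-∷ʳ []       y = trans (·-identityˡ (A y)) (sym (·-identityʳ (A y)))
M-∷ʳ (x ∷ xs) y = trans (cong (_· A x) (M-∷ʳ xs y)) (·-assoc (A y) (M xs) (A x))

-- pencil k x y = x·Id + y·A k
pencil : ℤ → ℤ → ℤ → Mat
pencil k x y = mat (x + y * k) (- y) y x

scalar : ℤ → Mat
scalar e = mat e (+ 0) (+ 0) e

-- Cayley–Hamilton: (A k)² = k·A k − Id.
pencil-·-A : ∀ k x y → pencil k x y · A k ≡ pencil k (- y) (x + y * k)
pencil-·-A k x y = trans (·-A (x + y * k) (- y) y x k)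
  (mat-cong (+-comm ((x + y * k) * k) (- y)) refl (+-comm (y * k) x) refl)

M-replicate : ∀ j k → ∃[ x ] ∃[ y ] M (replicate j k) ≡ pencil k x y
M-replicate zero    k = + 1 , + 0 , refl
M-replicate (suc j) k with M-replicate j k
... | x , y , eq = - y , x + y * k , trans (cong (_· A k) eq) (pencil-·-A k x y)

∷-initNE-lastNE : ∀ x xs → x ∷ xs ≡ initNE x xs ++ lastNE x xs ∷ []
∷-initNE-lastNE x []       = refl
∷-initNE-lastNE x (y ∷ ys) = cong (x ∷_) (∷-initNE-lastNE y ys)

length-initNE : ∀ x xs → length (initNE x xs) ≡ length xs
length-initNE x []       = refl
length-initNE x (y ∷ ys) = cong suc (length-initNE y ys)

length-⊕ : ∀ a₁ a₂ as b₁ b₂ bs →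
           length ((a₁ ∷ a₂ ∷ as) ⊕ (b₁ ∷ b₂ ∷ bs)) ≡ 2 ℕ.+ (length as ℕ.+ length bs)
length-⊕ a₁ a₂ as b₁ b₂ bs = cong suc (begin
  length (initNE a₂ as ++ lastNE a₂ as + b₁ ∷ initNE b₂ bs)
    ≡⟨ length-++ (initNE a₂ as) ⟩
  length (initNE a₂ as) ℕ.+ suc (length (initNE b₂ bs))
    ≡⟨ cong₂ (λ m n → m ℕ.+ suc n) (length-initNE a₂ as) (length-initNE b₂ bs) ⟩
  length as ℕ.+ suc (length bs)
    ≡⟨ +-suc (length as) (length bs) ⟩
  suc (length as ℕ.+ length bs)
    ∎)
  where open ≡-Reasoning

rot-↭ : ∀ r (xs : List ℤ) → rot r xs ↭ xs
rot-↭ r xs = ↭-trans (++-comm (drop r xs) (take r xs)) (↭-reflexive (take++drop≡id r xs))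

module Congruence (N : ℕ) where

  infix 4 _≈_ _≈ᴹ_

  -- Unlike the unfolding _≡[_]_ and _≡M[_]_, a record (and, for matrices, a data type
  -- indexed by the four entries) keeps the compared integers inferable and visible to solve.
  record _≈_ (x y : ℤ) : Set where
    constructor mod
    field divides-difference : + N ∣ x - y

  ≡[N]⇒≈ : ∀ {x y} → x ≡[ N ] y → x ≈ y
  ≡[N]⇒≈ {x} {y} h = mod (∣ᵤ⇒∣ {+ N} {x - y} h)

  ≈⇒≡[N] : ∀ {x y} → x ≈ y → x ≡[ N ] y
  ≈⇒≡[N] {x} {y} (mod h) = ∣⇒∣ᵤ {+ N} {x - y} h

  ≈-refl : ∀ {x} → x ≈ x
  ≈-refl {x} = mod (divides (+ 0) (+-inverseʳ x))

  ≈-sym : ∀ {x y} → x ≈ y → y ≈ x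
  ≈-sym {x} {y} (mod h) = mod (∣-resp-≡ (∣n⇒∣m*n (- + 1) h) (solve (x ∷ y ∷ [])))

  ≈-trans : ∀ {x y z} → x ≈ y → y ≈ z → x ≈ z
  ≈-trans {x} {y} {z} (mod h) (mod g) = mod (∣-resp-≡ (∣m∣n⇒∣m+n h g) (solve (x ∷ y ∷ z ∷ [])))

  +-cong : ∀ {x x′ y y′} → x ≈ x′ → y ≈ y′ → x + y ≈ x′ + y′
  +-cong {x} {x′} {y} {y′} (mod h) (mod g) =
    mod (∣-resp-≡ (∣m∣n⇒∣m+n h g) (solve (x ∷ x′ ∷ y ∷ y′ ∷ [])))

  *-cong : ∀ {x x′ y y′} → x ≈ x′ → y ≈ y′ → x * y ≈ x′ * y′
  *-cong {x} {x′} {y} {y′} (mod h) (mod g) =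
    mod (∣-resp-≡ (∣m∣n⇒∣m+n (∣n⇒∣m*n y′ h) (∣n⇒∣m*n x g)) (solve (x ∷ x′ ∷ y ∷ y′ ∷ [])))

  euclidsLemmaℤ : Prime N → ∀ x y → + N ∣ x * y → (+ N ∣ x) ⊎ (+ N ∣ y)
  euclidsLemmaℤ N-prime x y N∣xy =
    Sum.map (∣ᵤ⇒∣ {+ N} {x}) (∣ᵤ⇒∣ {+ N} {y})
      (euclidsLemma ∣ x ∣ ∣ y ∣ N-prime (subst (N ℕᵈ.∣_) (abs-* x y) (∣⇒∣ᵤ {+ N} {x * y} N∣xy)))

  data _≈ᴹ_ : Mat → Mat → Set where
    mat≈ : ∀ {a b c d a′ b′ c′ d′} → a ≈ a′ → b ≈ b′ → c ≈ c′ → d ≈ d′ →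
           mat a b c d ≈ᴹ mat a′ b′ c′ d′

  ≡M⇒≈ᴹ : ∀ {X Y} → X ≡M[ N ] Y → X ≈ᴹ Y
  ≡M⇒≈ᴹ {mat _ _ _ _} {mat _ _ _ _} (a , b , c , d) =
    mat≈ (≡[N]⇒≈ a) (≡[N]⇒≈ b) (≡[N]⇒≈ c) (≡[N]⇒≈ d)

  ≈ᴹ⇒≡M : ∀ {X Y} → X ≈ᴹ Y → X ≡M[ N ] Y
  ≈ᴹ⇒≡M (mat≈ a b c d) = ≈⇒≡[N] a , ≈⇒≡[N] b , ≈⇒≡[N] c , ≈⇒≡[N] d

  ≈ᴹ-sym : ∀ {X Y} → X ≈ᴹ Y → Y ≈ᴹ X
  ≈ᴹ-sym (mat≈ a b c d) = mat≈ (≈-sym a) (≈-sym b) (≈-sym c) (≈-sym d)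

  ≈ᴹ-trans : ∀ {X Y Z} → X ≈ᴹ Y → Y ≈ᴹ Z → X ≈ᴹ Z
  ≈ᴹ-trans (mat≈ a b c d) (mat≈ a′ b′ c′ d′) =
    mat≈ (≈-trans a a′) (≈-trans b b′) (≈-trans c c′) (≈-trans d d′)

  ·-cong : ∀ {X X′ Y Y′} → X ≈ᴹ X′ → Y ≈ᴹ Y′ → X · Y ≈ᴹ X′ · Y′
  ·-cong (mat≈ a b c d) (mat≈ e f g h) =
    mat≈ (+-cong (*-cong a e) (*-cong b g)) (+-cong (*-cong a f) (*-cong b h))
         (+-cong (*-cong c e) (*-cong d g)) (+-cong (*-cong c f) (*-cong d h))

  pencil≈scalar : ∀ {k x y e} → + N ∣ y → + N ∣ x + y * k + e → pencil k x y ≈ᴹ scalar (- e)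
  pencil≈scalar {k} {x} {y} {e} N∣y N∣s+e = mat≈
    (mod (∣-resp-≡ N∣s+e (solve (k ∷ x ∷ y ∷ e ∷ []))))
    (mod (∣-resp-≡ (∣n⇒∣m*n (- + 1) N∣y) (solve (y ∷ []))))
    (mod (∣-resp-≡ N∣y (solve (y ∷ []))))
    (mod (∣-resp-≡ (∣m∣n⇒∣m-n N∣s+e (∣n⇒∣m*n k N∣y)) (solve (k ∷ x ∷ y ∷ e ∷ []))))

  flank-pencil : Prime N → ∀ {e a₁ aₘ k x y} → e * e ≡ + 1 →
                 (A aₘ · pencil k x y) · A a₁ ≈ᴹ scalar e →
                 pencil k x y ≈ᴹ scalar (- e) ⊎ (a₁ ≈ k × aₘ ≈ k)
  flank-pencil N-prime {e} {a₁} {aₘ} {k} {x} {y} e²≡1 flank≈e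
    with subst (_≈ᴹ scalar e)
               (trans (cong (_· A a₁) (A-· aₘ (x + y * k) (- y) y x))
                      (·-A (aₘ * (x + y * k) - y) (aₘ * - y - x) (x + y * k) (- y) a₁))
               flank≈e
  ... | mat≈ (mod h₁₁) (mod h₁₂) (mod h₂₁) (mod h₂₂) =
    Sum.map (λ N∣aₘ → pencil≈scalar (∣m+n∣n⇒∣m N∣y+eaₘ (∣n⇒∣m*n e N∣aₘ)) N∣s+e)
            (λ N∣aₘ-k → a₁≈k N∣aₘ-k , mod N∣aₘ-k)
            (euclidsLemmaℤ N-prime aₘ (aₘ - k) (∣-cancel-unit e e²≡1 N∣e·aₘ[aₘ-k]))
    where
    entry₁₁ : + N ∣ (aₘ * (x + y * k) - y) * a₁ + (aₘ * - y - x) - e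
    entry₁₁ = h₁₁
    entry₁₂ : + N ∣ - (aₘ * (x + y * k) - y) - + 0
    entry₁₂ = h₁₂
    entry₂₁ : + N ∣ (x + y * k) * a₁ + - y - + 0
    entry₂₁ = h₂₁
    entry₂₂ : + N ∣ - (x + y * k) - e
    entry₂₂ = h₂₂
    N∣s+e : + N ∣ x + y * k + e
    N∣s+e = ∣-resp-≡ (∣n⇒∣m*n (- + 1) entry₂₂) (solve (e ∷ k ∷ x ∷ y ∷ []))
    N∣y+eaₘ : + N ∣ y + e * aₘ
    N∣y+eaₘ = ∣-resp-≡ (∣m∣n⇒∣m+n (∣n⇒∣m*n aₘ N∣s+e) entry₁₂) (solve (e ∷ aₘ ∷ k ∷ x ∷ y ∷ []))
    N∣y+ea₁ : + N ∣ y + e * a₁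
    N∣y+ea₁ = ∣-resp-≡ (∣m∣n⇒∣m-n (∣n⇒∣m*n a₁ N∣s+e) entry₂₁) (solve (e ∷ a₁ ∷ k ∷ x ∷ y ∷ []))
    N∣a₁-aₘ : + N ∣ a₁ - aₘ
    N∣a₁-aₘ = ∣-cancel-unit e e²≡1
      (∣-resp-≡ (∣m∣n⇒∣m-n N∣y+ea₁ N∣y+eaₘ) (solve (e ∷ a₁ ∷ aₘ ∷ y ∷ [])))
    -- With x + y·k ≡ −e and y ≡ −e·aₘ ≡ −e·a₁, the (1,1) entry is e + e·aₘ(aₘ − k).
    N∣e·aₘ[aₘ-k] : + N ∣ e * (aₘ * (aₘ - k))
    N∣e·aₘ[aₘ-k] = ∣-resp-≡
      (∣m∣n⇒∣m+n (∣m∣n⇒∣m+n entry₁₁ (∣n⇒∣m*n (+ 1 - aₘ * a₁) N∣s+e)) (∣n⇒∣m*n (a₁ + aₘ - k) N∣y+eaₘ))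
      (solve (e ∷ a₁ ∷ aₘ ∷ k ∷ x ∷ y ∷ []))
    a₁≈k : + N ∣ aₘ - k → a₁ ≈ k
    a₁≈k N∣aₘ-k = mod (∣-resp-≡ (∣m∣n⇒∣m+n N∣a₁-aₘ N∣aₘ-k) (solve (a₁ ∷ aₘ ∷ k ∷ [])))

module Solutions (N : ℕ) where
  open Congruence N
  open import Data.List.Relation.Unary.All using ([]; _∷_)
  open import Data.List.Relation.Binary.Pointwise using ([]; _∷_)

  M-cong : ∀ {xs ys} → Pointwise _≈_ xs ys → M xs ≈ᴹ M ys
  M-cong []            = mat≈ ≈-refl ≈-refl ≈-refl ≈-refl
  M-cong (x≈y ∷ xs≈ys) = ·-cong (M-cong xs≈ys) (mat≈ x≈y ≈-refl ≈-refl ≈-refl)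

  solution-cong : ∀ {xs ys} → Pointwise _≈_ xs ys → Solution N xs → Solution N ys
  solution-cong {xs} {ys} xs≈ys = Sum.map (transport {Id}) (transport {negM Id})
    where
    transport : ∀ {Z} → M xs ≡M[ N ] Z → M ys ≡M[ N ] Z
    transport {Z} h = ≈ᴹ⇒≡M (≈ᴹ-trans (≈ᴹ-sym (M-cong xs≈ys)) (≡M⇒≈ᴹ {M xs} {Z} h))

  All⇒Pointwise-replicate : ∀ {k xs} → All (_≈ k) xs → Pointwise _≈_ xs (replicate (length xs) k)
  All⇒Pointwise-replicate []           = []
  All⇒Pointwise-replicate (x≈k ∷ xs≈k) = x≈k ∷ All⇒Pointwise-replicate xs≈k

  Pointwise-All : ∀ {k xs ys} → Pointwise _≡[ N ]_ xs ys → All (_≡ k) xs → All (_≈ k) ys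
  Pointwise-All []            []            = []
  Pointwise-All (x≈y ∷ xs≈ys) (refl ∷ xs≡k) = ≈-sym (≡[N]⇒≈ x≈y) ∷ Pointwise-All xs≈ys xs≡k

  ↭-replicate : ∀ {n k c d} → c ↭ replicate n k → Pointwise _≡[ N ]_ c d →
                All (_≈ k) d × length d ≡ n
  ↭-replicate {n} c↭kⁿ c≈d =
    Pointwise-All c≈d (All-resp-↭ (↭-sym c↭kⁿ) (All.replicate⁺ n refl)) ,
    trans (sym (Pointwise-length c≈d)) (trans (↭-length c↭kⁿ) (length-replicate n))

  Equiv-replicate : ∀ {n k d} → Equiv N (replicate n k) d → All (_≈ k) d × length d ≡ n
  Equiv-replicate {n} {k} (r , inj₁ c≈d) = ↭-replicate (rot-↭ r (replicate n k)) c≈d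
  Equiv-replicate {n} {k} (r , inj₂ c≈d) =
    ↭-replicate (↭-trans (rot-↭ r (reverse (replicate n k))) (↭-reverse (replicate n k))) c≈d

  module _ (N-prime : Prime N) where

    flanked-scalar : ∀ e → e * e ≡ + 1 → ∀ a₁ j k aₘ →
                     M (a₁ ∷ replicate j k ++ aₘ ∷ []) ≡M[ N ] scalar e →
                     M (replicate j k) ≡M[ N ] scalar (- e) ⊎ (a₁ ≈ k × aₘ ≈ k)
    flanked-scalar e e²≡1 a₁ j k aₘ M≡e with M-replicate j k
    ... | x , y , kʲ≡pencil =
      Sum.map₁ (subst (_≡M[ N ] scalar (- e)) (sym kʲ≡pencil) ∘ ≈ᴹ⇒≡M)
               (flank-pencil N-prime e²≡1 (≡M⇒≈ᴹ {(A aₘ · pencil k x y) · A a₁} {scalar e}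
                                                 (subst (_≡M[ N ] scalar e) flank M≡e)))
      where
      flank : M (a₁ ∷ replicate j k ++ aₘ ∷ []) ≡ (A aₘ · pencil k x y) · A a₁
      flank = cong (_· A a₁) (trans (M-∷ʳ (replicate j k) aₘ) (cong (A aₘ ·_) kʲ≡pencil))

    flanked-solution : ∀ a₁ j k aₘ → Solution N (a₁ ∷ replicate j k ++ aₘ ∷ []) →
                       Solution N (replicate j k) ⊎ (a₁ ≈ k × aₘ ≈ k)
    flanked-solution a₁ j k aₘ (inj₁ M≡Id)  = Sum.map₁ inj₂ (flanked-scalar (+ 1) refl a₁ j k aₘ M≡Id)
    flanked-solution a₁ j k aₘ (inj₂ M≡-Id) = Sum.map₁ inj₁ (flanked-scalar (- + 1) refl a₁ j k aₘ M≡-Id)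

    shorter-monomial-solution : ∀ {k} a b → 3 ≤ length a → 3 ≤ length b →
                                All (_≈ k) (a ⊕ b) → Solution N a →
                                ∃[ m ] 1 ≤ m × m < length (a ⊕ b) × Solution N (replicate m k)
    shorter-monomial-solution {k} (a₁ ∷ a₂ ∷ a₃ ∷ as) (b₁ ∷ b₂ ∷ b₃ ∷ bs) _ _ (_ ∷ a⊕b≈k) sol =
      [ (λ kʲ-sol → shorter |as| (s≤s z≤n) (s≤s (m≤n⇒m≤1+n (m≤m+n |as| |bs|)))
                      (subst (λ j → Solution N (replicate j k)) (length-initNE a₂ (a₃ ∷ as)) kʲ-sol))
      , (λ (a₁≈k , aₘ≈k) → shorter (2 ℕ.+ |as|) (s≤s z≤n) (s≤s (s≤s (m<m+n |as| (s≤s z≤n))))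
                             (solution-cong (All⇒Pointwise-replicate (a-constant a₁≈k aₘ≈k)) sol))
      ]′ (flanked-solution a₁ (length mid) k aₘ flanked)
      where
      |as| = length (a₃ ∷ as)
      |bs| = length (b₃ ∷ bs)
      mid = initNE a₂ (a₃ ∷ as)
      aₘ = lastNE a₂ (a₃ ∷ as)
      a-split : a₂ ∷ a₃ ∷ as ≡ mid ++ aₘ ∷ []
      a-split = ∷-initNE-lastNE a₂ (a₃ ∷ as)
      mid≈k : All (_≈ k) mid
      mid≈k = All.++⁻ˡ mid a⊕b≈k
      flanked : Solution N (a₁ ∷ replicate (length mid) k ++ aₘ ∷ [])
      flanked = solution-cong (≈-refl ∷ Pointwise.++⁺ (All⇒Pointwise-replicate mid≈k) (≈-refl ∷ []))
                              (subst (Solution N ∘ (a₁ ∷_)) a-split sol)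
      a-constant : a₁ ≈ k → aₘ ≈ k → All (_≈ k) (a₁ ∷ a₂ ∷ a₃ ∷ as)
      a-constant a₁≈k aₘ≈k = a₁≈k ∷ subst (All (_≈ k)) (sym a-split) (All.++⁺ mid≈k (aₘ≈k ∷ []))
      shorter : ∀ m → 1 ≤ m → m < 2 ℕ.+ (|as| ℕ.+ |bs|) →
                Solution N (replicate m k) →
                ∃[ m ] 1 ≤ m × m < length ((a₁ ∷ a₂ ∷ a₃ ∷ as) ⊕ (b₁ ∷ b₂ ∷ b₃ ∷ bs))
                       × Solution N (replicate m k)
      shorter m 1≤m m<n sol-m =
        m , 1≤m , subst (m <_) (sym (length-⊕ a₁ a₂ (a₃ ∷ as) b₁ b₂ (b₃ ∷ bs))) m<n , sol-m
    shorter-monomial-solution []              _            ()             _              _ _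
    shorter-monomial-solution (_ ∷ [])        _            (s≤s ())       _              _ _
    shorter-monomial-solution (_ ∷ _ ∷ [])    _            (s≤s (s≤s ())) _              _ _
    shorter-monomial-solution (_ ∷ _ ∷ _ ∷ _) []           _              ()             _ _
    shorter-monomial-solution (_ ∷ _ ∷ _ ∷ _) (_ ∷ [])     _              (s≤s ())       _ _
    shorter-monomial-solution (_ ∷ _ ∷ _ ∷ _) (_ ∷ _ ∷ []) _              (s≤s (s≤s ())) _ _

mainTheorem3 : (N : ℕ) → Prime N → (k : ℤ) → (n : ℕ) →
    MinimalMonomial N k n →
    ¬ (n ≡ 2 × k ≡[ N ] (+ 0)) →
    Irreducible N (replicate n k)
mainTheorem3 N N-prime k n (_ , _ , minimal) _ (_ , a , b , sol-a , _ , 3≤|a| , 3≤|b| , kⁿ∼a⊕b) =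
  let a⊕b≈k , |a⊕b|≡n = Equiv-replicate kⁿ∼a⊕b
      m , 1≤m , m<|a⊕b| , sol-m = shorter-monomial-solution N-prime a b 3≤|a| 3≤|b| a⊕b≈k sol-a
  in minimal m 1≤m (subst (m <_) |a⊕b|≡n m<|a⊕b|) sol-m
  where open Solutions N
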